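{- Let $G$ be a graph whose cycle space has dimension $q$, let ${\cal G}=\{C_1,\dots,C_q\}$ be a set of generating cycles of $G$, and let $p({\cal G})$ be the number of elements of the set ${\cal P}({\cal G})$ of tuples of pairwise disjoint simple paths in the extended intersection graph $H({\cal G})$. Then $$p({\cal G})\geq 2^q-1,$$ with equality if and only if $H({\cal G})$ has no edges.
   Context: Graphs are finite, undirected and connected, and may have loops and multiple edges. The cycle space of $G$ is the $\mathbb{Z}_2$-vector space of edge sets generated by the simple cycles of $G$ under symmetric difference; its dimension is $q(G)=m(G)-n(G)+1$, where $m(G)$ and $n(G)$ are the numbers of edges and vertices. The extended intersection graph $H({\cal G})$ has one vertex $i$ for each cycle $C_i$. For each edge common to $C_i$ and $C_j$ it has an edge joining $i$ and $j$. In addition, for each vertex shared by $C_i$ and $C_j$ ($i\neq j$) that is not an endpoint of an edge of $C_i\cap C_j$, it has one more edge joining $i$ and $j$. Thus $H({\cal G})$ may have multiple edges and vertices of degree two. A path in $H$ is a sequence of edges, any two consecutive ones sharing a vertex; a constant path is a single vertex. A path is simple if every vertex appears at most once. Let ${\cal A}$ be the set of simple paths in $H$. Then ${\cal P}({\cal G})$ is the set of unordered tuples $(\Gamma_1,\dots,\Gamma_k)$ with $k\geq 1$ and $k\le m(G)$, with each $\Gamma_i\in{\cal A}$ and with the $\Gamma_i$ pairwise disjoint. For example, if $H$ consists of two vertices $1,2$ and one edge between them, then ${\cal P}=\{(1),(2),(12),(1,2)\}$. Finally, $p({\cal G})=|{\cal P}({\cal G})|$. -}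

module Defs where

open import Data.Nat using (ℕ; zero; suc; _+_)
import Data.Nat as ℕ
open import Data.Nat.DivMod using (_mod_)
open import Data.Fin using (Fin; toℕ; _≟_; _≤_)
open import Data.Fin.Properties using (_<?_)
open import Data.Bool using (Bool; true; false; _∧_; _xor_; not; if_then_else_)
open import Data.List using (List; []; _∷_; allFin; foldr; map; length)
open import Data.Bool.ListAction using (any)
open import Data.Nat.ListAction using (sum)
open import Data.List.Membership.Propositional using (_∈_)
open import Data.List.Relation.Unary.All using (All)
open import Data.List.Relation.Unary.AllPairs using (AllPairs)
open import Data.List.Relation.Unary.Unique.Propositional using (Unique)
open import Data.List.Relation.Binary.Permutation.Propositional using (↭-setoid)
open import Data.Product using (Σ; ∃; _×_; _,_; proj₁; proj₂)
open import Data.Sum using (_⊎_)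
open import Data.Empty using (⊥)
open import Function.Definitions using (Injective)
open import Function.Bundles using (Inverse)
open import Relation.Nullary.Decidable using (⌊_⌋)
open import Relation.Binary.Bundles using (Setoid)
open import Relation.Binary.PropositionalEquality using (_≡_)
import Relation.Binary.PropositionalEquality as ≡
import Relation.Binary.Construct.On as On

-- Finite multigraphs (loops and multiple edges allowed):
-- vertices Fin n, edges Fin m, each edge has a pair of endpoints.

record Graph : Set where
  field
    n    : ℕ
    m    : ℕ
    ends : Fin m → Fin n × Fin n

anyFin : ∀ {k} → (Fin k → Bool) → Bool
anyFin {k} f = any f (allFin k)

countFin : ∀ {k} → (Fin k → Bool) → ℕ
countFin {k} f = sum (map (λ x → if f x then 1 else 0) (allFin k))

cyc : ∀ {k} → Fin (suc k) → Fin (suc k)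
cyc {k} i = suc (toℕ i) mod suc k

module _ (G : Graph) where
  open Graph G

  Joins : Fin m → Fin n → Fin n → Set
  Joins e u v = ends e ≡ (u , v) ⊎ ends e ≡ (v , u)

  data Reach : Fin n → Fin n → Set where
    here  : ∀ {u} → Reach u u
    there : ∀ {u v w} (e : Fin m) → Joins e u v → Reach v w → Reach u w

  Connected : Set
  Connected = 1 ℕ.≤ n × (∀ u v → Reach u v)

  -- A simple cycle: distinct vertices v_0..v_k and distinct edges
  -- e_0..e_k with e_i joining v_i and v_{i+1 mod (k+1)}.
  -- (k = 0: a loop; k = 1: two parallel edges.)
  record Cycle : Set where
    field
      k      : ℕ
      vs     : Fin (suc k) → Fin n
      es     : Fin (suc k) → Fin m
      vs-inj : Injective _≡_ _≡_ vs
      es-inj : Injective _≡_ _≡_ es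
      joins  : ∀ i → Joins (es i) (vs i) (vs (cyc i))

  inE : Cycle → Fin m → Bool
  inE C e = anyFin (λ i → ⌊ Cycle.es C i ≟ e ⌋)

  inV : Cycle → Fin n → Bool
  inV C v = anyFin (λ i → ⌊ Cycle.vs C i ≟ v ⌋)

  isEnd : Fin m → Fin n → Bool
  isEnd e v = ⌊ proj₁ (ends e) ≟ v ⌋ Data.Bool.∨ ⌊ proj₂ (ends e) ≟ v ⌋

  -- Z2-combination (symmetric difference) of the cycles C_i with S i = true
  comb : ∀ {q} → (Fin q → Cycle) → (Fin q → Bool) → Fin m → Bool
  comb {q} C S e = foldr (λ i acc → (S i ∧ inE (C i) e) xor acc) false (allFin q)

  -- C_1..C_q generate the cycle space: every simple cycle of G is a
  -- symmetric difference of some of the C_i.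
  Generates : ∀ {q} → (Fin q → Cycle) → Set
  Generates C = ∀ (D : Cycle) → ∃ λ S → ∀ e → comb C S e ≡ inE D e

  -- Extended intersection graph H: number of edges between i and j (i ≠ j)
  rawMult : ∀ {q} → (Fin q → Cycle) → Fin q → Fin q → ℕ
  rawMult C i j =
    countFin (λ e → inE (C i) e ∧ inE (C j) e)
    + countFin (λ v → inV (C i) v ∧ inV (C j) v ∧
         not (anyFin (λ e → inE (C i) e ∧ inE (C j) e ∧ isEnd e v)))

  multH : ∀ {q} → (Fin q → Cycle) → Fin q → Fin q → ℕ
  multH C i j =
    if ⌊ i <? j ⌋ then rawMult C i j
    else (if ⌊ j <? i ⌋ then rawMult C j i else 0)

-- Simple paths in a multigraph on Fin q whose edges between u and v
-- are labelled by Fin (mult u v), and tuples of disjoint simple paths.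

module Paths (q : ℕ) (mult : Fin q → Fin q → ℕ) where

  data Walk : Fin q → Set where
    stop : (v : Fin q) → Walk v
    step : (u v : Fin q) → Fin (mult u v) → Walk v → Walk u

  verts : ∀ {u} → Walk u → List (Fin q)
  verts (stop v)       = v ∷ []
  verts (step u _ _ w) = u ∷ verts w

  endV : ∀ {u} → Walk u → Fin q
  endV (stop v)       = v
  endV (step _ _ _ w) = endV w

  RPath : Set
  RPath = Σ (Fin q) Walk

  Simple : RPath → Set
  Simple (_ , w) = Unique (verts w)

  -- a path and its reverse are the same path: choose the orientation
  -- whose start vertex is ≤ its end vertex
  Canonical : RPath → Set
  Canonical (u , w) = u ≤ endV w

  Disjoint : RPath → RPath → Set
  Disjoint (_ , w) (_ , w') = ∀ x → x ∈ verts w → x ∈ verts w' → ⊥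

  Tuple : ℕ → Set
  Tuple bound = Σ (List RPath) λ ps →
    All Simple ps × All Canonical ps × AllPairs Disjoint ps ×
    1 ℕ.≤ length ps × length ps ℕ.≤ bound

  -- unordered: tuples are identified up to permutation
  TupleSetoid : ℕ → Setoid _ _
  TupleSetoid bound = On.setoid {B = Tuple bound} (↭-setoid {A = RPath}) proj₁

  HasCount : ℕ → ℕ → Set
  HasCount bound p = Inverse (≡.setoid (Fin p)) (TupleSetoid bound)

IsP : (G : Graph) {q : ℕ} → (Fin q → Cycle G) → ℕ → Set
IsP G {q} C p = Paths.HasCount q (multH G C) (Graph.m G) p

NoEdgesH : (G : Graph) {q : ℕ} → (Fin q → Cycle G) → Set
NoEdgesH G C = ∀ i j → multH G C i j ≡ 0

module Submission where

-- Write N = 2^q − 1.  Every nonempty set S of vertices of H gives the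
-- tuple of constant paths (v)_{v ∈ S}; distinct sets give distinct unordered
-- tuples, so 𝒫(𝒢) contains N pairwise inequivalent tuples and p ≥ N.  If H
-- has no edges, every path is constant, so every tuple is of this form and is
-- determined by its set of start vertices: p ≤ N.  If H has an edge a—c, the
-- one-edge path (a c) is a further tuple not of this form: p ≥ N + 1.

open import Defs
open import Data.Nat using (ℕ; zero; suc; _+_; _^_; _∸_; _≤_; z≤n; s≤s)
import Data.Nat.Properties as ℕ
open import Data.Fin using (Fin; zero; suc; toℕ; cast; combine; funToFin; finToFun; punchOut)
  renaming (_≤_ to _≤ᶠ_)
open import Data.Fin.Properties
  using (toℕ-injective; toℕ-cast; toℕ-↑ˡ; toℕ<n; cast-involutive; funToFin-finToFin;
         finToFun-funToFin; any?; 0≢1+n; ¬Fin0; suc-injective; punchOut-injective;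
         injective⇒≤; _<?_)
  renaming (_≟_ to _≟ᶠ_; ≤-refl to ≤ᶠ-refl; ≤-total to ≤ᶠ-total; <-irrefl to <ᶠ-irrefl;
            <-asym to <ᶠ-asym)
open import Data.List using (List; []; _∷_; map; filter; allFin; length)
open import Data.List.Properties using (length-map; length-filter; length-tabulate)
open import Data.List.Membership.Propositional using (_∈_)
open import Data.List.Membership.Propositional.Properties using (∈-map⁺; ∈-map⁻; ∈-filter⁺; ∈-filter⁻; ∈-allFin)
open import Data.List.Membership.Propositional.Properties.WithK using (unique∧set⇒bag)
open import Data.List.Membership.DecPropositional using () renaming (_∈?_ to member?)
open import Data.List.Relation.Unary.Any using (here)
open import Data.List.Relation.Unary.All using ([]; _∷_)
import Data.List.Relation.Unary.All as All
import Data.List.Relation.Unary.All.Properties as All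
open import Data.List.Relation.Unary.AllPairs using (AllPairs; []; _∷_)
import Data.List.Relation.Unary.AllPairs as AllPairs
import Data.List.Relation.Unary.AllPairs.Properties as AllPairs
open import Data.List.Relation.Unary.Unique.Propositional using (Unique)
open import Data.List.Relation.Unary.Unique.Propositional.Properties using (allFin⁺; filter⁺)
open import Data.List.Relation.Binary.Permutation.Propositional using (_↭_; ↭-sym)
open import Data.List.Relation.Binary.Permutation.Propositional.Properties using (∈-resp-↭)
open import Data.List.Relation.Binary.BagAndSetEquality using (∼bag⇒↭)
open import Data.Product using (Σ; ∃; _×_; _,_; proj₁; proj₂)
open import Data.Sum using (inj₁; inj₂)
open import Data.Empty using (⊥-elim)
open import Function using (_∘_)
open import Function.Bundles using (Inverse; _⇔_; mk⇔)
open import Relation.Binary.Bundles using (Setoid)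
open import Relation.Nullary using (Dec; yes; no; ¬_; contradiction)
open import Relation.Binary.PropositionalEquality
open ≡-Reasoning

module Counting {c ℓ} (S : Setoid c ℓ) {p : ℕ}
                (count : Inverse (setoid (Fin p)) S) where
  open Setoid S using (Carrier; _≈_) renaming (trans to ≈-trans; sym to ≈-sym)
  open Inverse count

  injection⇒≤ : ∀ {n} (f : Fin n → Carrier) → (∀ {i j} → f i ≈ f j → i ≡ j) → n ≤ p
  injection⇒≤ f f-inj = injective⇒≤ {f = from ∘ f} λ {i} {j} eq →
    f-inj (≈-trans (≈-sym (strictlyInverseˡ (f i))) (≈-trans (to-cong eq) (strictlyInverseˡ (f j))))

  ≤-injection : ∀ {n} (g : Carrier → Fin n) → (∀ {x y} → g x ≡ g y → x ≈ y) → p ≤ n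
  ≤-injection g g-inj = injective⇒≤ {f = g ∘ to} λ {i} {j} eq →
    trans (sym (strictlyInverseʳ i)) (trans (from-cong (g-inj eq)) (strictlyInverseʳ j))

∈⇒nonempty : ∀ {a} {A : Set a} {x : A} {xs} → x ∈ xs → 1 ≤ length xs
∈⇒nonempty {xs = _ ∷ _} _ = s≤s z≤n

same-elements⇒↭ : ∀ {a} {A : Set a} {xs ys : List A} → Unique xs → Unique ys →
  (∀ {x} → x ∈ xs → x ∈ ys) → (∀ {x} → x ∈ ys → x ∈ xs) → xs ↭ ys
same-elements⇒↭ xs! ys! xs⊆ys ys⊆xs = ∼bag⇒↭ (unique∧set⇒bag xs! ys! (mk⇔ xs⊆ys ys⊆xs))

-- Subsets of Fin q, coded by Fin (2 ^ q) = Fin (1 + N).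

funToFin-cong : ∀ {m n} {f g : Fin m → Fin n} → (∀ i → f i ≡ g i) → funToFin f ≡ funToFin g
funToFin-cong {zero}  _   = refl
funToFin-cong {suc m} f≗g = cong₂ combine (f≗g zero) (funToFin-cong (f≗g ∘ suc))

toℕ-funToFin-zero : ∀ m {n} → toℕ (funToFin {m} {suc n} (λ _ → zero)) ≡ 0
toℕ-funToFin-zero zero    = refl
toℕ-funToFin-zero (suc m) {n} =
  trans (toℕ-↑ˡ (funToFin {m} {suc n} (λ _ → zero)) _) (toℕ-funToFin-zero m)

Fin2-ext : ∀ (x y : Fin 2) → (x ≡ suc zero → y ≡ suc zero) → (y ≡ suc zero → x ≡ suc zero) → x ≡ y
Fin2-ext zero       zero       _ _ = refl
Fin2-ext zero       (suc zero) _ y⇒x with () ← y⇒x refl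
Fin2-ext (suc zero) zero       x⇒y _ with () ← x⇒y refl
Fin2-ext (suc zero) (suc zero) _ _ = refl

indicator : ∀ {a} {A : Set a} → Dec A → Fin 2
indicator (yes _) = suc zero
indicator (no _)  = zero

indicator⁺ : ∀ {a} {A : Set a} (d : Dec A) → A → indicator d ≡ suc zero
indicator⁺ (yes _) _ = refl
indicator⁺ (no ¬a) a = contradiction a ¬a

indicator⁻ : ∀ {a} {A : Set a} (d : Dec A) → indicator d ≡ suc zero → A
indicator⁻ (yes a) _ = a

module SubsetCodes (q : ℕ) where

  N : ℕ
  N = 2 ^ q ∸ 1

  2^q≡1+N : 2 ^ q ≡ suc N
  2^q≡1+N = sym (ℕ.m+[n∸m]≡n (ℕ.m^n>0 2 q))

  Indicator : Set
  Indicator = Fin q → Fin 2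

  _∋_ : Indicator → Fin q → Set
  χ ∋ v = χ v ≡ suc zero

  ∅ : Indicator
  ∅ _ = zero

  up : Fin (2 ^ q) → Fin (suc N)
  up = cast 2^q≡1+N

  down : Fin (suc N) → Fin (2 ^ q)
  down = cast (sym 2^q≡1+N)

  code : Indicator → Fin (suc N)
  code χ = up (funToFin χ)

  decode : Fin (suc N) → Indicator
  decode k = finToFun (down k)

  decode-code : ∀ χ v → decode (code χ) v ≡ χ v
  decode-code χ v = begin
    finToFun (down (up (funToFin χ))) v
      ≡⟨ cong (λ k → finToFun k v) (cast-involutive (sym 2^q≡1+N) 2^q≡1+N (funToFin χ)) ⟩
    finToFun (funToFin χ) v
      ≡⟨ finToFun-funToFin χ v ⟩
    χ v ∎

  code-decode : ∀ k → code (decode k) ≡ k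
  code-decode k = begin
    up (funToFin {q} {2} (finToFun (down k)))
      ≡⟨ cong up (funToFin-finToFin {q} {2} (down k)) ⟩
    up (down k)
      ≡⟨ cast-involutive 2^q≡1+N (sym 2^q≡1+N) k ⟩
    k ∎

  code-cong : ∀ {χ χ'} → (∀ v → χ ∋ v → χ' ∋ v) → (∀ v → χ' ∋ v → χ ∋ v) → code χ ≡ code χ'
  code-cong χ⊆χ' χ'⊆χ =
    cong up (funToFin-cong λ v → Fin2-ext _ _ (χ⊆χ' v) (χ'⊆χ v))

  code-injective : ∀ {χ χ'} → code χ ≡ code χ' → ∀ v → χ v ≡ χ' v
  code-injective {χ} {χ'} eq v =
    trans (sym (decode-code χ v)) (trans (cong (λ k → decode k v) eq) (decode-code χ' v))

  code-∅ : code ∅ ≡ zero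
  code-∅ = toℕ-injective (trans (toℕ-cast 2^q≡1+N _) (toℕ-funToFin-zero q))

  code-nonzero : ∀ {χ v} → χ ∋ v → zero ≢ code χ
  code-nonzero {χ} {v} χ∋v zero≡code = 0≢1+n (begin
    zero                   ≡⟨ decode-code ∅ v ⟨
    decode (code ∅) v      ≡⟨ cong (λ k → decode k v) (trans code-∅ zero≡code) ⟩
    decode (code χ) v      ≡⟨ decode-code χ v ⟩
    χ v                    ≡⟨ χ∋v ⟩
    suc zero               ∎)

  decode-suc-inhabited : ∀ i → ∃ λ v → decode (suc i) ∋ v
  decode-suc-inhabited i with any? (λ v → decode (suc i) v ≟ᶠ suc zero)
  ... | yes found = found
  ... | no none = ⊥-elim (0≢1+n (begin
    zero                   ≡⟨ code-∅ ⟨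
    code ∅                 ≡⟨ code-cong (λ _ ()) (λ v ∋v → ⊥-elim (none (v , ∋v))) ⟩
    code (decode (suc i))  ≡⟨ code-decode (suc i) ⟩
    suc i                  ∎))

  members : Indicator → List (Fin q)
  members χ = filter (λ v → χ v ≟ᶠ suc zero) (allFin q)

  members-unique : ∀ χ → Unique (members χ)
  members-unique χ = filter⁺ _ (allFin⁺ q)

  ∈-members⁺ : ∀ {χ v} → χ ∋ v → v ∈ members χ
  ∈-members⁺ {χ} {v} = ∈-filter⁺ (λ v → χ v ≟ᶠ suc zero) (∈-allFin v)

  ∈-members⁻ : ∀ {χ v} → v ∈ members χ → χ ∋ v
  ∈-members⁻ {χ} = proj₂ ∘ ∈-filter⁻ (λ v → χ v ≟ᶠ suc zero) {xs = allFin q}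

  length-members : ∀ χ → length (members χ) ≤ q
  length-members χ = ℕ.≤-trans (length-filter _ (allFin q)) (ℕ.≤-reflexive (length-tabulate _))

module ConstantPaths (q : ℕ) (mult : Fin q → Fin q → ℕ) (bound : ℕ) (q≤bound : q ≤ bound) where
  open Paths q mult
  open SubsetCodes q

  open Counting (TupleSetoid bound) using (injection⇒≤; ≤-injection)

  -- a path meets itself, so disjoint paths are different.
  start∈verts : ∀ {u} (w : Walk u) → u ∈ verts w
  start∈verts (stop _)       = here refl
  start∈verts (step _ _ _ _) = here refl

  disjoint⇒≢ : ∀ {r r'} → Disjoint r r' → r ≢ r'
  disjoint⇒≢ {u , w} disj refl = disj u (start∈verts w) (start∈verts w)

  point : Fin q → RPath
  point v = v , stop v

  points : List (Fin q) → List RPath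
  points = map point

  ∈-points⁻ : ∀ {v vs} → point v ∈ points vs → v ∈ vs
  ∈-points⁻ p with ∈-map⁻ point p
  ... | _ , w∈vs , refl = w∈vs

  ↭-points⇒⊆ : ∀ {vs ws} → points vs ↭ points ws → ∀ {v} → v ∈ vs → v ∈ ws
  ↭-points⇒⊆ σ v∈vs = ∈-points⁻ (∈-resp-↭ σ (∈-map⁺ point v∈vs))

  pointTuple : (vs : List (Fin q)) → Unique vs → 1 ≤ length vs → length vs ≤ bound → Tuple bound
  pointTuple vs vs! nonempty short =
      points vs
    , All.map⁺ (All.universal (λ _ → [] ∷ []) vs)
    , All.map⁺ (All.universal (λ _ → ≤ᶠ-refl) vs)
    , AllPairs.map⁺ (AllPairs.map distinct⇒disjoint vs!)
    , subst (1 ≤_) (sym (length-map point vs)) nonempty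
    , subst (_≤ bound) (sym (length-map point vs)) short
    where
    distinct⇒disjoint : ∀ {v w} → v ≢ w → Disjoint (point v) (point w)
    distinct⇒disjoint v≢w _ (here refl) (here refl) = v≢w refl

  -- the tuple of the nonempty subset coded by suc i.
  subsetTuple : Fin N → Tuple bound
  subsetTuple i = pointTuple (members χ) (members-unique χ)
    (∈⇒nonempty (∈-members⁺ (proj₂ (decode-suc-inhabited i))))
    (ℕ.≤-trans (length-members χ) q≤bound)
    where χ = decode (suc i)

  subsetTuple-injective : ∀ {i j} → proj₁ (subsetTuple i) ↭ proj₁ (subsetTuple j) → i ≡ j
  subsetTuple-injective {i} {j} σ = suc-injective (begin
    suc i                  ≡⟨ code-decode (suc i) ⟨
    code (decode (suc i))  ≡⟨ code-cong (λ _ → ∈-members⁻ ∘ ↭-points⇒⊆ σ ∘ ∈-members⁺)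
                                        (λ _ → ∈-members⁻ ∘ ↭-points⇒⊆ (↭-sym σ) ∘ ∈-members⁺) ⟩
    code (decode (suc j))  ≡⟨ code-decode (suc j) ⟩
    suc j                  ∎)

  N≤count : ∀ {p} → HasCount bound p → N ≤ p
  N≤count count = injection⇒≤ count subsetTuple subsetTuple-injective

  -- Without edges every tuple consists of constant paths and is determined
  -- by its set of start vertices.
  module NoEdges (no-edges : ∀ u v → mult u v ≡ 0) where

    constant : ∀ r → r ≡ point (proj₁ r)
    constant (_ , stop _)       = refl
    constant (u , step u v e _) = ⊥-elim (¬Fin0 (subst Fin (no-edges u v) e))

    starts : List RPath → Indicator
    starts L v = indicator (member? _≟ᶠ_ v (map proj₁ L))

    ∈⇒starts : ∀ {r L} → r ∈ L → starts L ∋ proj₁ r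
    ∈⇒starts {r} {L} r∈L = indicator⁺ (member? _≟ᶠ_ (proj₁ r) (map proj₁ L)) (∈-map⁺ proj₁ r∈L)

    starts⇒∈ : ∀ {r L} → starts L ∋ proj₁ r → r ∈ L
    starts⇒∈ {r} {L} ∋r with ∈-map⁻ proj₁ (indicator⁻ (member? _≟ᶠ_ (proj₁ r) (map proj₁ L)) ∋r)
    ... | r' , r'∈L , start≡ =
      subst (_∈ L) (trans (constant r') (trans (cong point (sym start≡)) (sym (constant r)))) r'∈L

    starts-nonzero : ∀ r L → zero ≢ code (starts (r ∷ L))
    starts-nonzero r L = code-nonzero {starts (r ∷ L)} (∈⇒starts {r} {r ∷ L} (here refl))

    -- the code of the (nonempty) set of start vertices, shifted down by one.
    index : Tuple bound → Fin N
    index ([] , _ , _ , _ , () , _)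
    index (r ∷ L , _) = punchOut (starts-nonzero r L)

    index-injective : ∀ {x y} → index x ≡ index y → proj₁ x ↭ proj₁ y
    index-injective {[] , _ , _ , _ , () , _}
    index-injective {_ ∷ _ , _} {[] , _ , _ , _ , () , _}
    index-injective {r ∷ L , _ , _ , L-disj , _} {r' ∷ L' , _ , _ , L'-disj , _} eq =
      same-elements⇒↭ (AllPairs.map disjoint⇒≢ L-disj) (AllPairs.map disjoint⇒≢ L'-disj)
        (λ s∈ → starts⇒∈ (subst (_≡ suc zero) (same-starts _) (∈⇒starts s∈)))
        (λ s∈ → starts⇒∈ (subst (_≡ suc zero) (sym (same-starts _)) (∈⇒starts s∈)))
      where
      same-starts : ∀ v → starts (r ∷ L) v ≡ starts (r' ∷ L') v
      same-starts = code-injective (punchOut-injective (starts-nonzero r L) (starts-nonzero r' L') eq)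

    count≤N : ∀ {p} → HasCount bound p → p ≤ N
    count≤N count = ≤-injection count index index-injective

  -- A canonical one-edge path a—c gives one more tuple, not made of constant paths.
  module OneEdge {a c : Fin q} (a≢c : a ≢ c) (a≤c : a ≤ᶠ c) (e : Fin (mult a c)) where

    edgePath : RPath
    edgePath = a , step a c e (stop c)

    edgeTuple : Tuple bound
    edgeTuple = edgePath ∷ [] , ((a≢c ∷ []) ∷ [] ∷ []) ∷ [] , a≤c ∷ [] , [] ∷ [] , s≤s z≤n ,
                ℕ.≤-trans (ℕ.≤-trans (s≤s z≤n) (toℕ<n a)) q≤bound

    edge≁points : ∀ {vs} → ¬ (edgePath ∷ [] ↭ points vs)
    edge≁points σ with ∈-map⁻ point (∈-resp-↭ σ (here refl))
    ... | _ , _ , ()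

    extendedTuple : Fin (suc N) → Tuple bound
    extendedTuple zero    = edgeTuple
    extendedTuple (suc i) = subsetTuple i

    extendedTuple-injective : ∀ {i j} → proj₁ (extendedTuple i) ↭ proj₁ (extendedTuple j) → i ≡ j
    extendedTuple-injective {zero}  {zero}  _ = refl
    extendedTuple-injective {zero}  {suc j} σ = ⊥-elim (edge≁points σ)
    extendedTuple-injective {suc i} {zero}  σ = ⊥-elim (edge≁points (↭-sym σ))
    extendedTuple-injective {suc i} {suc j} σ = cong suc (subsetTuple-injective σ)

    N<count : ∀ {p} → HasCount bound p → suc N ≤ p
    N<count count = injection⇒≤ count extendedTuple extendedTuple-injective

-- The extended intersection graph H(𝒢) is loopless and symmetric, so each
-- of its edges can be traversed as a canonical one-edge path.

module IntersectionGraph (G : Graph) {q : ℕ} (C : Fin q → Cycle G) where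

  multH-loopless : ∀ i → multH G C i i ≡ 0
  multH-loopless i with i <? i
  ... | yes i<i = ⊥-elim (<ᶠ-irrefl refl i<i)
  ... | no _    = refl

  multH-sym : ∀ i j → multH G C i j ≡ multH G C j i
  multH-sym i j with i <? j | j <? i
  ... | yes i<j | yes j<i = contradiction j<i (<ᶠ-asym i<j)
  ... | yes _   | no _    = refl
  ... | no _    | yes _   = refl
  ... | no _    | no _    = refl

  canonicalEdge : ∀ i j {t} → multH G C i j ≡ suc t →
    Σ (Fin q) λ a → Σ (Fin q) λ c → a ≢ c × a ≤ᶠ c × Fin (multH G C a c)
  canonicalEdge i j i—j with ≤ᶠ-total i j
  ... | inj₁ i≤j = i , j , distinct , i≤j , subst Fin (sym i—j) zero
    where distinct : i ≢ j
          distinct refl = ℕ.0≢1+n (trans (sym (multH-loopless i)) i—j)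
  ... | inj₂ j≤i = j , i , distinct , j≤i , subst Fin (sym (trans (multH-sym j i) i—j)) zero
    where distinct : j ≢ i
          distinct refl = ℕ.0≢1+n (trans (sym (multH-loopless j)) i—j)

-- the cycle space has dimension at most the number of edges (as n ≥ 1).
rank≤edges : ∀ {q n m} → q + n ≡ m + 1 → 1 ≤ n → q ≤ m
rank≤edges {q} {n} {m} q+n≡m+1 1≤n =
  ℕ.+-cancelʳ-≤ 1 q m (subst (q + 1 ≤_) q+n≡m+1 (ℕ.+-monoʳ-≤ q 1≤n))

lemma2p2 : (G : Graph) → Connected G →
    (q : ℕ) → q + Graph.n G ≡ Graph.m G + 1 →
    (C : Fin q → Cycle G) → Generates G C →
    (p : ℕ) → IsP G C p →
    (2 ^ q ∸ 1 ≤ p) × (p ≡ 2 ^ q ∸ 1 ⇔ NoEdgesH G C)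
lemma2p2 G (1≤n , _) q q+n≡m+1 C _ p count =
  N≤count count , mk⇔ exact⇒edgeless edgeless⇒exact
  where
  open ConstantPaths q (multH G C) (Graph.m G) (rank≤edges q+n≡m+1 1≤n)
  open IntersectionGraph G C

  edgeless⇒exact : NoEdgesH G C → p ≡ 2 ^ q ∸ 1
  edgeless⇒exact no-edges = ℕ.≤-antisym (NoEdges.count≤N no-edges count) (N≤count count)

  exact⇒edgeless : p ≡ 2 ^ q ∸ 1 → NoEdgesH G C
  exact⇒edgeless p≡N i j with multH G C i j in i—j
  ... | zero  = refl
  ... | suc _ with a , c , a≢c , a≤c , e ← canonicalEdge i j i—j =
    ⊥-elim (ℕ.<-irrefl (sym p≡N) (OneEdge.N<count a≢c a≤c e count))
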